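{- Let $A$ be an admissible set of addition chains and $n$ a positive integer. Then: (1) $\delta^A_{st}(n)\le\delta^A(n)$, with equality if and only if $n$ is $A$-stable; (2) $\ell^A_{st}(n)\le\ell^A(n)$, with equality if and only if $n$ is $A$-stable.
   Context: An addition chain for a positive integer $n$ is a sequence $(a_0,\ldots,a_r)$ with $a_0=1$, $a_r=n$, and for every $1\le k\le r$ there exist $0\le i,j<k$ with $a_k=a_i+a_j$; $r$ is its length. For a set $A$ of addition chains, $\ell^A(n)$ is the least length of an addition chain for $n$ belonging to $A$. $\nu_2(n)$ is the number of $1$'s in the binary expansion of $n$. $A$ is admissible if (i) for every $n\ge1$, $\ell^A(n)$ is defined and $\ell^A(n)\le\lfloor\log_2 n\rfloor+\nu_2(n)-1$, and (ii) for every $n\ge1$, $\ell^A(2n)\le\ell^A(n)+1$. The $A$-defect is $\delta^A(n)=\ell^A(n)-\log_2 n$. A positive integer $m$ is $A$-stable if $\ell^A(2^k m)=\ell^A(m)+k$ for all $k\ge0$. For every $n$ there exists $k\ge0$ with $2^kn$ $A$-stable; the stable defect is $\delta^A_{st}(n)=\delta^A(2^kn)$ and the stable length is $\ell^A_{st}(n)=\ell^A(2^kn)-k$, for any $k\ge0$ such that $2^kn$ is $A$-stable (both are independent of the choice of such $k$). -}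

module Defs where

open import Data.Nat using (ℕ; zero; suc; _+_; _*_; _∸_; _^_; _≤_; _<_)
open import Data.Nat.DivMod using (_/_; _%_)
open import Data.Nat.Logarithm using (⌊log₂_⌋)
open import Data.Fin using (Fin; toℕ; fromℕ) renaming (_<_ to _<ᶠ_)
open import Data.Vec using (Vec; lookup)
open import Data.Product using (Σ; ∃; ∃₂; _×_; proj₁)
open import Relation.Binary.PropositionalEquality using (_≡_)

-- A sequence (a_0, ..., a_r): its length r together with the r+1 entries.
Sequence : Set
Sequence = Σ ℕ (λ r → Vec ℕ (suc r))

chainLength : Sequence → ℕ
chainLength = proj₁

record IsAdditionChainFor (n : ℕ) (c : Sequence) : Set where
  field
    first : lookup (Data.Product.proj₂ c) Fin.zero ≡ 1
    last  : lookup (Data.Product.proj₂ c) (fromℕ (proj₁ c)) ≡ n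
    step  : (k : Fin (suc (proj₁ c))) → 0 < toℕ k →
            ∃₂ λ (i j : Fin (suc (proj₁ c))) → i <ᶠ k × j <ᶠ k ×
              lookup (Data.Product.proj₂ c) k
                ≡ lookup (Data.Product.proj₂ c) i + lookup (Data.Product.proj₂ c) j

-- A set of addition chains (a predicate on sequences; elements that are not
-- addition chains are irrelevant since only chains for n are ever considered).
ChainSet : Set₁
ChainSet = Sequence → Set

HasChainOfLength : ChainSet → ℕ → ℕ → Set
HasChainOfLength A n r = ∃ λ c → A c × IsAdditionChainFor n c × chainLength c ≡ r

ℓIs : ChainSet → ℕ → ℕ → Set
ℓIs A n r = HasChainOfLength A n r × (∀ r′ → HasChainOfLength A n r′ → r ≤ r′)

-- ν₂(n): number of 1's in the binary expansion (fuel n suffices since n/2 < n).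
popcountFuel : ℕ → ℕ → ℕ
popcountFuel zero    _ = 0
popcountFuel (suc f) n = n % 2 + popcountFuel f (n / 2)

ν₂ : ℕ → ℕ
ν₂ n = popcountFuel n n

Admissible : ChainSet → Set
Admissible A =
  (∀ n → 1 ≤ n → ∃ λ r → ℓIs A n r × r ≤ ⌊log₂ n ⌋ + ν₂ n ∸ 1) ×
  (∀ n → 1 ≤ n → ∀ r s → ℓIs A n r → ℓIs A (2 * n) s → s ≤ r + 1)

Stable : ChainSet → ℕ → Set
Stable A m = ∀ k r → ℓIs A m r → ℓIs A (2 ^ k * m) (r + k)

-- Comparison of defects δ = ℓ - log₂ m without reals:
-- ℓ₁ - log₂ m₁ ≤ ℓ₂ - log₂ m₂  ⇔  2^ℓ₁ * m₂ ≤ 2^ℓ₂ * m₁  (exponentiating, m₁, m₂ > 0).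
DefectLe : ℕ → ℕ → ℕ → ℕ → Set
DefectLe ℓ₁ m₁ ℓ₂ m₂ = 2 ^ ℓ₁ * m₂ ≤ 2 ^ ℓ₂ * m₁

-- DefectEq ℓ₁ m₁ ℓ₂ m₂ says  (ℓ₁ - log₂ m₁) = (ℓ₂ - log₂ m₂).
DefectEq : ℕ → ℕ → ℕ → ℕ → Set
DefectEq ℓ₁ m₁ ℓ₂ m₂ = 2 ^ ℓ₁ * m₂ ≡ 2 ^ ℓ₂ * m₁

{-# OPTIONS --safe #-}
-- Since δ(2^k n) − δ(n) = ℓ(2^k n) − ℓ(n) − k, both parts compare s = ℓ(2^k n) with
-- ℓ(n) + k. Admissibility (ii) gives ℓ(2^i m) ≤ ℓ(m) + i, hence s ≤ ℓ(n) + k. When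
-- equality holds, squeezing with the same bound gives ℓ(2^j n) = ℓ(n) + j for j ≤ k,
-- and stability of 2^k n gives it for j ≥ k, so n is stable.
module Submission where

open import Defs
open import Data.Nat as Nat using (ℕ; _≤_; _<_; _^_; _*_; _+_; suc; zero; z≤n; s≤s; >-nonZero)
open import Data.Nat.Properties as ℕ
  using (≤-total; ≤⇒≤″; <-cmp; +-assoc; +-comm; *-assoc; *-comm)
open import Data.Integer as Int using (+_; _-_; +≤+) renaming (_≤_ to _≤ℤ_)
import Data.Integer.Properties as ℤ
open import Algebra.Properties.AbelianGroup ℤ.+-0-abelianGroup using (//-rightDividesˡ; //-rightDividesʳ)
open import Data.Product using (∃; _×_; _,_)
open import Data.Sum using (inj₁; inj₂)
open import Algebra.Definitions.RawMagma Nat.+-rawMagma using (_,_)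
open import Function.Bundles using (_⇔_; mk⇔)
open import Function.Properties.Equivalence using () renaming (trans to ⇔-trans)
open import Relation.Binary.Definitions using (tri<; tri≈; tri>)
open import Relation.Binary.PropositionalEquality
open import Relation.Nullary using (contradiction)

private
  variable
    A : ChainSet
    m n a b r s : ℕ

2^[i+j]*m≡2^j*[2^i*m] : ∀ i j m → 2 ^ (i + j) * m ≡ 2 ^ j * (2 ^ i * m)
2^[i+j]*m≡2^j*[2^i*m] i j m = begin
  2 ^ (i + j) * m       ≡⟨ cong (_* m) (ℕ.^-distribˡ-+-* 2 i j) ⟩
  2 ^ i * 2 ^ j * m     ≡⟨ cong (_* m) (*-comm (2 ^ i) (2 ^ j)) ⟩
  2 ^ j * 2 ^ i * m     ≡⟨ *-assoc (2 ^ j) (2 ^ i) m ⟩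
  2 ^ j * (2 ^ i * m)   ∎
  where open ≡-Reasoning

1≤2^i*m : ∀ i → 1 ≤ m → 1 ≤ 2 ^ i * m
1≤2^i*m i 1≤m = ℕ.*-mono-≤ (ℕ.m^n>0 2 i) 1≤m

^-injectiveʳ : ∀ x → 1 < x → x ^ a ≡ x ^ b → a ≡ b
^-injectiveʳ {a} {b} x 1<x eq with <-cmp a b
... | tri< a<b _ _ = contradiction eq (ℕ.<⇒≢ (ℕ.^-monoʳ-< x 1<x a<b))
... | tri≈ _ a≡b _ = a≡b
... | tri> _ _ a>b = contradiction (sym eq) (ℕ.<⇒≢ (ℕ.^-monoʳ-< x 1<x a>b))

ℓIs-unique : ℓIs A m a → ℓIs A m b → a ≡ b
ℓIs-unique (chain₁ , least₁) (chain₂ , least₂) =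
  ℕ.≤-antisym (least₁ _ chain₂) (least₂ _ chain₁)

ℓIs-defined : Admissible A → 1 ≤ m → ∃ (ℓIs A m)
ℓIs-defined (bounded , _) 1≤m with bounded _ 1≤m
... | r , ℓ≡r , _ = r , ℓ≡r

ℓIs-2^*-≤ : Admissible A → 1 ≤ m → ∀ i → ℓIs A m a → ℓIs A (2 ^ i * m) b → b ≤ a + i
ℓIs-2^*-≤ {A} {m} {a} _ _ zero ℓm ℓ1*m =
  ℕ.≤-reflexive (trans (ℓIs-unique ℓ1*m (subst (λ x → ℓIs A x a) (sym (ℕ.*-identityˡ m)) ℓm))
                       (sym (ℕ.+-identityʳ a)))
ℓIs-2^*-≤ {A} {m} {a} {b} adm@(_ , doubling) 1≤m (suc i) ℓm ℓ2^[1+i]*m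
  with ℓIs-defined adm (1≤2^i*m i 1≤m)
... | t , ℓ2^i*m = begin
  b          ≤⟨ doubling _ (1≤2^i*m i 1≤m) t b ℓ2^i*m
                  (subst (λ x → ℓIs A x b) (*-assoc 2 (2 ^ i) m) ℓ2^[1+i]*m) ⟩
  t + 1      ≤⟨ ℕ.+-monoˡ-≤ 1 (ℓIs-2^*-≤ adm 1≤m i ℓm ℓ2^i*m) ⟩
  a + i + 1  ≡⟨ +-assoc a i 1 ⟩
  a + (i + 1) ≡⟨ cong (λ x → a + x) (+-comm i 1) ⟩
  a + suc i  ∎
  where open ℕ.≤-Reasoning

ℓIs-2^*-tight-below : Admissible A → 1 ≤ m → ∀ e f → ℓIs A m a →
  ℓIs A (2 ^ (e + f) * m) (a + (e + f)) → ℓIs A (2 ^ e * m) (a + e)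
ℓIs-2^*-tight-below {A} {m} {a} adm 1≤m e f ℓm ℓ2^[e+f]*m
  with ℓIs-defined adm (1≤2^i*m e 1≤m)
... | t , ℓ2^e*m = subst (ℓIs _ _) (ℕ.≤-antisym (ℓIs-2^*-≤ adm 1≤m e ℓm ℓ2^e*m) a+e≤t) ℓ2^e*m
  where
  a+e+f≤t+f : a + e + f ≤ t + f
  a+e+f≤t+f = subst (_≤ t + f) (sym (+-assoc a e f))
    (ℓIs-2^*-≤ adm (1≤2^i*m e 1≤m) f ℓ2^e*m
      (subst (λ x → ℓIs A x (a + (e + f))) (2^[i+j]*m≡2^j*[2^i*m] e f m) ℓ2^[e+f]*m))
  a+e≤t : a + e ≤ t
  a+e≤t = ℕ.+-cancelʳ-≤ f (a + e) t a+e+f≤t+f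

Stable⇒ℓIs-2^* : Stable A n → ∀ k → ℓIs A n r → ℓIs A (2 ^ k * n) s → s ≡ r + k
Stable⇒ℓIs-2^* stable k ℓn ℓ2^k*n = ℓIs-unique ℓ2^k*n (stable k _ ℓn)

Stable-from-tight-2^* : Admissible A → 1 ≤ n → ∀ k → Stable A (2 ^ k * n) → ℓIs A n r →
  ℓIs A (2 ^ k * n) (r + k) → Stable A n
Stable-from-tight-2^* {n = n} {r} adm 1≤n k stable ℓn ℓ2^k*n j r′ ℓ′n
  rewrite ℓIs-unique ℓ′n ℓn with ≤-total k j
... | inj₁ k≤j with ≤⇒≤″ k≤j
...   | d , refl = subst₂ (ℓIs _) (sym (2^[i+j]*m≡2^j*[2^i*m] k d n)) (+-assoc r k d)
                     (stable d (r + k) ℓ2^k*n)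
Stable-from-tight-2^* adm 1≤n k stable ℓn ℓ2^k*n j r′ ℓ′n | inj₂ j≤k with ≤⇒≤″ j≤k
...   | f , refl = ℓIs-2^*-tight-below adm 1≤n j f ℓn ℓ2^k*n

DefectLe-2^* : s ≤ r + a → DefectLe s (2 ^ a * n) r n
DefectLe-2^* {s} {r} {a} {n} s≤r+a = begin
  2 ^ s * n          ≤⟨ ℕ.*-monoˡ-≤ n (ℕ.^-monoʳ-≤ 2 s≤r+a) ⟩
  2 ^ (r + a) * n    ≡⟨ cong (λ x → 2 ^ x * n) (+-comm r a) ⟩
  2 ^ (a + r) * n    ≡⟨ 2^[i+j]*m≡2^j*[2^i*m] a r n ⟩
  2 ^ r * (2 ^ a * n) ∎
  where open ℕ.≤-Reasoning

DefectEq-2^*⇔ : 1 ≤ n → DefectEq s (2 ^ a * n) r n ⇔ s ≡ r + a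
DefectEq-2^*⇔ {n} {s} {a} {r} 1≤n = mk⇔ cancel (λ { refl → 2^[r+a]*n≡2^r*[2^a*n] })
  where
  2^[r+a]*n≡2^r*[2^a*n] : 2 ^ (r + a) * n ≡ 2 ^ r * (2 ^ a * n)
  2^[r+a]*n≡2^r*[2^a*n] = trans (cong (λ x → 2 ^ x * n) (+-comm r a)) (2^[i+j]*m≡2^j*[2^i*m] a r n)
  cancel : 2 ^ s * n ≡ 2 ^ r * (2 ^ a * n) → s ≡ r + a
  cancel eq = ^-injectiveʳ 2 (s≤s (s≤s z≤n))
    (ℕ.*-cancelʳ-≡ _ _ n {{>-nonZero 1≤n}} (trans eq (sym 2^[r+a]*n≡2^r*[2^a*n])))

[+m]-[+n]≤+o : ∀ {m n o} → m ≤ o + n → + m - + n ≤ℤ + o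
[+m]-[+n]≤+o {m} {n} {o} m≤o+n =
  ℤ.≤-trans (ℤ.+-monoˡ-≤ (Int.- + n) (+≤+ m≤o+n)) (ℤ.≤-reflexive (//-rightDividesʳ (+ n) (+ o)))

[+m]-[+n]≡+o⇔ : ∀ m n o → (+ m - + n ≡ + o) ⇔ m ≡ o + n
[+m]-[+n]≡+o⇔ m n o = mk⇔
  (λ eq → ℤ.+-injective (trans (sym (//-rightDividesˡ (+ n) (+ m))) (cong (Int._+ + n) eq)))
  (λ { refl → //-rightDividesʳ (+ n) (+ o) })

proposition3p12 : (A : ChainSet) → Admissible A →
    (n : ℕ) → 1 ≤ n → (k : ℕ) → Stable A (2 ^ k * n) →
    (r s : ℕ) → ℓIs A n r → ℓIs A (2 ^ k * n) s →
    (DefectLe s (2 ^ k * n) r n × (DefectEq s (2 ^ k * n) r n ⇔ Stable A n)) ×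
    ((+ s - + k) ≤ℤ + r × ((+ s - + k) ≡ + r ⇔ Stable A n))
proposition3p12 A adm n 1≤n k stable r s ℓn ℓ2^k*n =
  (DefectLe-2^* {r = r} {a = k} s≤r+k , ⇔-trans (DefectEq-2^*⇔ {a = k} {r = r} 1≤n) tight⇔stable) ,
  ([+m]-[+n]≤+o s≤r+k , ⇔-trans ([+m]-[+n]≡+o⇔ s k r) tight⇔stable)
  where
  s≤r+k : s ≤ r + k
  s≤r+k = ℓIs-2^*-≤ adm 1≤n k ℓn ℓ2^k*n
  tight⇔stable : s ≡ r + k ⇔ Stable A n
  tight⇔stable = mk⇔
    (λ { refl → Stable-from-tight-2^* adm 1≤n k stable ℓn ℓ2^k*n })
    (λ stableₙ → Stable⇒ℓIs-2^* stableₙ k ℓn ℓ2^k*n)
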